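{- Let $T$ be a finite rooted tree in which every inner node has at least two children, let $L$ be its set of leaves and $V$ its set of nodes. Let $S\subseteq V\setminus L$ and let $(\pi,\sigma)$ be a pair of injective maps from $S$ to $L$ which identifies $S$ and has unique request. Then for each $a\in\pi(S)$, the node $\pi^{ -1}(a)$ is the least ancestor of $a$ which belongs to $S$.
   Context: Every node is an ancestor (and descendant) of itself. A pair $(\pi,\sigma)$ of injective maps from $S$ to $L$ identifies $S$ if for each $s\in S$, $s$ is the least common ancestor of $\pi(s)$ and $\sigma(s)$. For $s\in S$ and a node $x$, $x$ is $s$-requested in $(\pi,\sigma)$ if $x$ lies on the path from $\pi(s)$ to $\sigma(s)$ in $T$. The pair $(\pi,\sigma)$ has unique request if every node $x$ of $T$ is $s$-requested for at most one $s\in S$. -}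

module Defs where

open import Data.Nat using (ℕ; _≥_)
open import Data.Fin using (Fin)
open import Data.List using (List; []; length; lookup)
open import Data.List.Relation.Unary.All using (All)
open import Data.Product using (_×_)
open import Data.Sum using (_⊎_)
open import Relation.Binary.PropositionalEquality using (_≡_)

data Tree : Set where
  node : List Tree → Tree

children : Tree → List Tree
children (node cs) = cs

data Full : Tree → Set where
  full : ∀ {cs} → (cs ≡ [] ⊎ length cs ≥ 2) → All Full cs → Full (node cs)

-- Nodes of a tree t, given as positions (paths from the root).
data Pos : Tree → Set where
  here  : ∀ {t} → Pos t
  there : ∀ {cs} (i : Fin (length cs)) → Pos (lookup cs i) → Pos (node cs)

subtree : ∀ {t} → Pos t → Tree
subtree {t} here = t
subtree (there i p) = subtree p

IsLeaf : ∀ {t} → Pos t → Set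
IsLeaf p = children (subtree p) ≡ []

-- x ≼ y : x is an ancestor of y (reflexive: every node is its own ancestor).
data _≼_ : ∀ {t} → Pos t → Pos t → Set where
  here≼  : ∀ {t} {p : Pos t} → here ≼ p
  there≼ : ∀ {cs} {i : Fin (length cs)} {p q : Pos (lookup cs i)} →
           p ≼ q → there {cs} i p ≼ there i q

IsLCA : ∀ {t} → Pos t → Pos t → Pos t → Set
IsLCA z x y = z ≼ x × z ≼ y × (∀ w → w ≼ x → w ≼ y → w ≼ z)

-- x lies on the (unique) path from u to v in the tree: x is an ancestor of
-- u or of v, and a descendant of the least common ancestor of u and v.
OnPath : ∀ {t} → Pos t → Pos t → Pos t → Set
OnPath x u v = (x ≼ u ⊎ x ≼ v) × (∀ z → IsLCA z u v → z ≼ x)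

InjectiveIntoLeaves : ∀ {t} → (Pos t → Set) → (Pos t → Pos t) → Set
InjectiveIntoLeaves S f =
  (∀ s → S s → IsLeaf (f s)) ×
  (∀ s s' → S s → S s' → f s ≡ f s' → s ≡ s')

module _ {t : Tree} (S : Pos t → Set) (π σ : Pos t → Pos t) where

  Identifies : Set
  Identifies = ∀ s → S s → IsLCA s (π s) (σ s)

  Requested : Pos t → Pos t → Set
  Requested s x = OnPath x (π s) (σ s)

  UniqueRequest : Set
  UniqueRequest = ∀ x s s' → S s → S s' → Requested s x → Requested s' x → s ≡ s'

IsLeastAncestorIn : ∀ {t} → (Pos t → Set) → Pos t → Pos t → Set
IsLeastAncestorIn S s a = S s × s ≼ a × (∀ s' → S s' → s' ≼ a → s' ≼ s)

{-# OPTIONS --safe #-}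
-- Ancestors of a node form a chain. So an ancestor s' ∈ S of a = π s that is not
-- above s lies between s = lca(π s, σ s) and π s, hence is s-requested; it is also
-- s'-requested, being lca(π s', σ s'). Unique request then gives s' = s.
module Submission where

open import Defs
open import Data.Product using (_,_; proj₁)
open import Data.Sum using (_⊎_; inj₁; inj₂)
open import Relation.Nullary using (¬_)
open import Relation.Binary.PropositionalEquality using (_≡_; refl; subst)

≼-refl : ∀ {t} (p : Pos t) → p ≼ p
≼-refl here        = here≼
≼-refl (there i p) = there≼ (≼-refl p)

≼-trans : ∀ {t} {p q r : Pos t} → p ≼ q → q ≼ r → p ≼ r
≼-trans here≼      _          = here≼
≼-trans (there≼ a) (there≼ b) = there≼ (≼-trans a b)

ancestors-comparable : ∀ {t} {p q r : Pos t} → p ≼ r → q ≼ r → p ≼ q ⊎ q ≼ p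
ancestors-comparable here≼      _          = inj₁ here≼
ancestors-comparable (there≼ _) here≼      = inj₂ here≼
ancestors-comparable (there≼ a) (there≼ b) with ancestors-comparable a b
... | inj₁ p≼q = inj₁ (there≼ p≼q)
... | inj₂ q≼p = inj₂ (there≼ q≼p)

onPath-below-lca : ∀ {t} {z x u v : Pos t} →
                   IsLCA z u v → z ≼ x → x ≼ u → OnPath x u v
onPath-below-lca (_ , _ , greatest) z≼x x≼u =
  inj₁ x≼u , λ w (w≼u , w≼v , _) → ≼-trans (greatest w w≼u w≼v) z≼x

lca-onPath : ∀ {t} {z u v : Pos t} → IsLCA z u v → OnPath z u v
lca-onPath {z = z} lca@(z≼u , _) = onPath-below-lca lca (≼-refl z) z≼u

lemma3p3 : (t : Tree) → Full t →
    (S : Pos t → Set) → (∀ s → S s → ¬ IsLeaf s) →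
    (π σ : Pos t → Pos t) →
    InjectiveIntoLeaves S π → InjectiveIntoLeaves S σ →
    Identifies S π σ → UniqueRequest S π σ →
    ∀ a s → S s → π s ≡ a → IsLeastAncestorIn S s a
lemma3p3 t _ S _ π σ _ _ identifies unique .(π s) s Ss refl =
  Ss , s≼πs , least
  where
  s≼πs : s ≼ π s
  s≼πs = proj₁ (identifies s Ss)

  least : ∀ s' → S s' → s' ≼ π s → s' ≼ s
  least s' Ss' s'≼πs with ancestors-comparable s'≼πs s≼πs
  ... | inj₁ s'≼s = s'≼s
  ... | inj₂ s≼s' = subst (_≼ s) s≡s' (≼-refl s)
    where
    s≡s' : s ≡ s'
    s≡s' = unique s' s s' Ss Ss'
      (onPath-below-lca (identifies s Ss) s≼s' s'≼πs)
      (lca-onPath (identifies s' Ss'))
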